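{- Let $\mathcal{I}$ be an instance of 3-SAT with variables $x_1,\dots,x_k$ and clauses $c_1,\dots,c_l$, and let $G=G(\mathcal{I})$ be the graph defined in the context. Let $\sigma$ be an MNS ordering of $G$ whose last vertex is $t$. Then (1) the vertex $b$ precedes every clause vertex $c_1,\dots,c_l$ in $\sigma$, and (2) the vertex $s$ precedes $b$ in $\sigma$.
   Context: Construction of $G(\mathcal{I})$ for a 3-SAT instance $\mathcal{I}$ with variables $x_1,\dots,x_k$ and clauses $c_1,\dots,c_l$ (each clause a disjunction of three literals): the vertex set consists of literal vertices $X=\{x_1,\dots,x_k,\overline{x}_1,\dots,\overline{x}_k\}$, clause vertices $C=\{c_1,\dots,c_l\}$, and three further vertices $s,b,t$. Edges: every pair of distinct literal vertices is adjacent except the pairs $x_i\overline{x}_i$ ($1\le i\le k$); $C$ is an independent set; each clause vertex $c_j$ is adjacent to every literal vertex except the (three) literal vertices corresponding to the literals occurring in clause $c_j$; $b$ is adjacent to all literal vertices; $s$ and $t$ are each adjacent to all literal vertices and all clause vertices; and $bt$ is an edge. There are no other edges (in particular $s$ is adjacent to neither $b$ nor $t$). An MNS ordering of a graph with $n$ vertices is an ordering produced by: choose an arbitrary first vertex; at each subsequent step, where the label of an unnumbered vertex $w$ is the set of positions of already numbered neighbours of $w$, number next an unnumbered vertex whose label is maximal under set inclusion among unnumbered vertices (any tie-break allowed). -}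

module Defs where

open import Data.Nat using (ℕ)
open import Data.Fin using (Fin; _<_; _≤_)
open import Data.Bool using (Bool)
open import Data.Product using (_×_; ∃)
open import Data.Sum using (_⊎_)
open import Data.Empty using (⊥)
open import Data.Unit using (⊤)
open import Relation.Binary.PropositionalEquality using (_≡_)
open import Relation.Nullary using (¬_)

-- A literal over variables x_1..x_k: (variable index, polarity);
-- polarity true = x_i, false = negated x_i.
Literal : ℕ → Set
Literal k = Fin k × Bool

Clause : ℕ → Set
Clause k = Literal k × Literal k × Literal k

_occursIn_ : ∀ {k} → Literal k → Clause k → Set
ℓ occursIn (ℓ₁ Data.Product., ℓ₂ Data.Product., ℓ₃) = ℓ ≡ ℓ₁ ⊎ ℓ ≡ ℓ₂ ⊎ ℓ ≡ ℓ₃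

record Instance (k l : ℕ) : Set where
  field
    clause : Fin l → Clause k
open Instance public

data Vertex (k l : ℕ) : Set where
  lit : Literal k → Vertex k l
  cl  : Fin l → Vertex k l
  s b t : Vertex k l

Adj : ∀ {k l} → Instance k l → Vertex k l → Vertex k l → Set
Adj I (lit (x Data.Product., _)) (lit (y Data.Product., _)) = ¬ (x ≡ y)
Adj I (lit ℓ) (cl j) = ¬ (ℓ occursIn clause I j)
Adj I (cl j) (lit ℓ) = ¬ (ℓ occursIn clause I j)
Adj I (lit _) s = ⊤
Adj I (lit _) b = ⊤
Adj I (lit _) t = ⊤
Adj I s (lit _) = ⊤
Adj I b (lit _) = ⊤
Adj I t (lit _) = ⊤
Adj I (cl _) s = ⊤
Adj I (cl _) t = ⊤
Adj I s (cl _) = ⊤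
Adj I t (cl _) = ⊤
Adj I b t = ⊤
Adj I t b = ⊤
Adj I _ _ = ⊥

IsOrdering : ∀ {k l n} → (Fin n → Vertex k l) → Set
IsOrdering {n = n} σ =
  (∀ (i j : Fin n) → σ i ≡ σ j → i ≡ j) × (∀ v → ∃ λ i → σ i ≡ v)

-- Label of vertex w at step i (before σ i is numbered): the set of
-- positions m < i with σ m adjacent to w.  LabelSub I σ i u w means
-- label_i(u) ⊆ label_i(w).
LabelSub : ∀ {k l n} → Instance k l → (Fin n → Vertex k l) → Fin n →
           Vertex k l → Vertex k l → Set
LabelSub {n = n} I σ i u w = ∀ (m : Fin n) → m < i → Adj I (σ m) u → Adj I (σ m) w

-- MNS ordering: at each step i the chosen vertex σ i has a label maximal
-- under inclusion among the unnumbered vertices σ j (j ≥ i).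
IsMNS : ∀ {k l n} → Instance k l → (Fin n → Vertex k l) → Set
IsMNS {n = n} I σ =
  IsOrdering σ ×
  (∀ (i j : Fin n) → i < j → LabelSub I σ i (σ i) (σ j) → LabelSub I σ i (σ j) (σ i))

-- When b (resp. s) is numbered, t is still unnumbered and every numbered
-- neighbour of b (resp. s) is also a neighbour of t, so label(b) ⊆ label(t);
-- maximality then forces label(t) ⊆ label(b).  A clause vertex (resp. b) is
-- adjacent to t but not to b (resp. s), so it cannot have been numbered
-- earlier.
module Submission where

open import Defs
open import Data.Nat using (ℕ)
open import Data.Fin using (Fin; _<_; _≤_)
open import Data.Fin.Properties using (<-cmp; ≤∧≢⇒<)
open import Data.Nat.Properties using (<⇒≱)
open import Data.Product using (_×_; _,_; proj₁; proj₂)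
open import Data.Empty using (⊥-elim)
open import Relation.Nullary using (¬_)
open import Data.Unit using (tt)
open import Relation.Binary.Definitions using (tri<; tri≈; tri>)
open import Relation.Binary.PropositionalEquality using (_≡_; _≢_; refl; sym; trans; cong; subst; subst₂)

module _ {k l : ℕ} (I : Instance k l) where

  DominatedBy : Vertex k l → Vertex k l → Set
  DominatedBy u v = ∀ x → x ≢ v → Adj I x u → Adj I x v

  b-dominatedBy-t : DominatedBy b t
  b-dominatedBy-t (lit _) _ _ = tt
  b-dominatedBy-t t t≢t _     = ⊥-elim (t≢t refl)

  s-dominatedBy-t : DominatedBy s t
  s-dominatedBy-t (lit _) _ _ = tt
  s-dominatedBy-t (cl _)  _ _ = tt
  s-dominatedBy-t t t≢t _     = ⊥-elim (t≢t refl)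

  dominated-precedes-privateNeighbour :
    ∀ {n} {σ : Fin n → Vertex k l} {u v w} → IsMNS I σ → (∀ i p → σ p ≡ v → i ≤ p) →
    DominatedBy u v → u ≢ v → u ≢ w → Adj I w v → ¬ Adj I w u →
    ∀ {i j} → σ i ≡ u → σ j ≡ w → i < j
  dominated-precedes-privateNeighbour {n} {σ} {v = v} ((_ , surjective) , maximal)
    v-last u⊑v u≢v u≢w wv ¬wu {i} {j} σi σj with <-cmp i j
  ... | tri< i<j _ _ = i<j
  ... | tri≈ _ refl _ = ⊥-elim (u≢w (trans (sym σi) σj))
  ... | tri> _ _ j<i = ⊥-elim (¬wu (subst₂ (Adj I) σj σi (label-v⊆label-u j j<i w-adj-σp)))
    where
    p : Fin n
    p = proj₁ (surjective v)

    σp : σ p ≡ v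
    σp = proj₂ (surjective v)

    i<p : i < p
    i<p = ≤∧≢⇒< (v-last i p σp) (λ i≡p → u≢v (trans (sym σi) (trans (cong σ i≡p) σp)))

    label-u⊆label-v : LabelSub I σ i (σ i) (σ p)
    label-u⊆label-v m m<i adj = subst (Adj I (σ m)) (sym σp)
      (u⊑v (σ m) (λ σm≡v → <⇒≱ m<i (v-last i m σm≡v)) (subst (Adj I (σ m)) σi adj))

    label-v⊆label-u : LabelSub I σ i (σ p) (σ i)
    label-v⊆label-u = maximal i p i<p label-u⊆label-v

    w-adj-σp : Adj I (σ j) (σ p)
    w-adj-σp = subst₂ (Adj I) (sym σj) (sym σp) wv

lemma3 : ∀ (k l : ℕ) (I : Instance k l) (n : ℕ) (σ : Fin n → Vertex k l) →
    IsMNS I σ →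
    (∀ (i j : Fin n) → σ j ≡ t → i ≤ j) →
    (∀ (i j : Fin n) (c : Fin l) → σ i ≡ b → σ j ≡ cl c → i < j) ×
    (∀ (i j : Fin n) → σ i ≡ s → σ j ≡ b → i < j)
lemma3 k l I n σ mns t-last =
    (λ _ _ _ → dominated-precedes-privateNeighbour I mns t-last
                 (b-dominatedBy-t I) (λ ()) (λ ()) tt (λ ()))
  , (λ _ _ → dominated-precedes-privateNeighbour I mns t-last
                 (s-dominatedBy-t I) (λ ()) (λ ()) tt (λ ()))
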